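{- Let $d,k$ be positive integers with $k=d(d+1)$. Suppose that $G$ is an $n$-vertex graph with the $d$-neighbourly property and whose $k$-core has at least $5n/9$ vertices. Then there exist an ordering $v_1,\dots,v_n$ of the vertices of $G$ and integers $s<t$ such that: (1) $v_1,\dots,v_s$ are the vertices of the $k$-core of $G$; (2) $v_{s+1},\dots,v_t$ are exactly the vertices contained in the $(d+1)$-core of $G$ but not in the $k$-core of $G$; (3) for each $s+1\le i\le n$, the vertex $v_i$ is adjacent to at least $d$ vertices of $\{v_1,\dots,v_{i-1}\}$.
   Context: A graph $G=(V,E)$ has the $d$-neighbourly property if every subset $B\subset V$ with $1\le |B|\le |V|/2$ contains a vertex with at least $d$ neighbours in $V\setminus B$. The $j$-core of a graph is its maximal subgraph in which every vertex has degree at least $j$. -}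

module Defs where

open import Data.Nat using (ℕ; _≤_; _<_; _*_; _<ᵇ_)
open import Data.Bool using (Bool; true; false; not; _∧_)
open import Data.Fin using (Fin; toℕ)
open import Data.Fin.Subset using (Subset; _∈_; _∉_; _⊆_; ∁; _∩_; ∣_∣)
open import Data.Vec using (tabulate)
open import Data.Product using (Σ; _×_; ∃)
open import Relation.Binary.PropositionalEquality using (_≡_)
open import Function.Bundles using (Inverse; _↔_)

record Graph (n : ℕ) : Set where
  field
    adj   : Fin n → Fin n → Bool
    sym   : ∀ u v → adj u v ≡ adj v u
    irrefl : ∀ v → adj v v ≡ false
open Graph public

nbhd : ∀ {n} → Graph n → Fin n → Subset n
nbhd G v = tabulate (adj G v)

degIn : ∀ {n} → Graph n → Subset n → Fin n → ℕ
degIn G S v = ∣ S ∩ nbhd G v ∣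

Neighbourly : ∀ {n} → ℕ → Graph n → Set
Neighbourly {n} d G =
  (B : Subset n) → 1 ≤ ∣ B ∣ → 2 * ∣ B ∣ ≤ n →
  Σ (Fin n) λ v → v ∈ B × d ≤ degIn G (∁ B) v

MinDegAtLeast : ∀ {n} → ℕ → Graph n → Subset n → Set
MinDegAtLeast j G C = ∀ v → v ∈ C → j ≤ degIn G C v

IsCore : ∀ {n} → ℕ → Graph n → Subset n → Set
IsCore {n} j G C =
  MinDegAtLeast j G C × (∀ (C′ : Subset n) → MinDegAtLeast j G C′ → C′ ⊆ C)

-- An ordering v_1..v_n : position i (0-based) ↦ vertex.
Ordering : ℕ → Set
Ordering n = Fin n ↔ Fin n

before : ∀ {n} → Ordering n → Fin n → Subset n
before σ i = tabulate λ w → toℕ (Inverse.from σ w) <ᵇ toℕ i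

module Submission where

-- Starting from the k-core K, which has at least 5n/9 vertices, the complement of any
-- superset of K has at most n/2 vertices, so the neighbourly property repeatedly supplies
-- a new vertex with d neighbours among those already placed: this lists V ∖ K as
-- m₁, m₂, … with every mᵢ having d neighbours in K ∪ {m₁, …, mᵢ₋₁}.  Moving the vertices
-- of the (d+1)-core D to the front of this list keeps the property, because no vertex
-- outside D precedes one of its neighbours in D.  Indeed, let R be the set of vertices
-- from which D is reached along a path that moves forward in the list.  Each vertex of
-- R ∖ D has its d earlier neighbours in D ∪ R and one later neighbour in R, so D ∪ R has
-- minimum degree d + 1 and R ⊆ D by maximality of the core.

open import Defs hiding (sym)
open import Data.Bool using (Bool; true)
open import Data.Bool.Properties using (T-≡)
open import Data.Empty using (⊥-elim)
open import Data.Fin using (Fin; toℕ; fromℕ<; punchOut)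
open import Data.Fin.Properties
  using (toℕ<n; toℕ-fromℕ<; toℕ-injective; any?; injective⇒≤; punchOut-injective; _≟_)
open import Data.Fin.Subset using (Subset; _∈_; _∉_; _⊆_; ∁; _∩_; _∪_; ⁅_⁆; ⊥; ∣_∣; Nonempty)
open import Data.Fin.Subset.Properties
  using ( _∈?_; nonempty?; ∉⊥; ∈⊤; ⊆⊤; ∣⊤∣≡n; ∣p∣≤n; ∣∁p∣≡n∸∣p∣; p⊆q⇒∣p∣≤∣q∣; p⊂q⇒∣p∣<∣q∣
        ; x∈p⇒∣p-x∣<∣p∣; x∈⁅x⁆; x∈⁅y⁆⇒x≡y; x∈p∩q⁺; x∈p∩q⁻; x∈p∪q⁺; x∈p∪q⁻; p⊆p∪q; q⊆p∪q
        ; x∈∁p⇒x∉p; x∈p⇒x∉∁p; x∉p⇒x∈∁p; x∉∁p⇒x∈p; p⊆q⇒∁p⊇∁q )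
open import Data.List using (List; []; _∷_; length)
open import Data.List.Membership.Propositional using () renaming (_∈_ to _∈ₗ_)
open import Data.List.Relation.Unary.Any using (here; there)
open import Data.Nat using (ℕ; zero; suc; _≤_; _<_; _+_; _*_; _∸_; _<ᵇ_; z≤n; s≤s; s≤s⁻¹; >-nonZero)
open import Data.Nat.Properties
  using ( ≤-refl; ≤-trans; <-trans; <-≤-trans; <-irrefl; <-cmp; <⇒≢; <⇒≱; <⇒≯; ≤⇒≯; ≮⇒≥; n≮0; n≤1+n
        ; <⇒<ᵇ; <ᵇ⇒<
        ; m≤n+m; m≤n*m; m∸n+n≡m; +-comm; +-identityʳ; +-cancelʳ-≡; +-cancelʳ-≤; +-monoˡ-≤; +-monoʳ-≤
        ; +-monoˡ-<; +-mono-<-≤; +-mono-≤-<; +-mono-≤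
        ; *-suc; *-monoˡ-≤; *-monoʳ-≤; *-cancelˡ-≤; *-distribˡ-+; *-distribʳ-+
        ; module ≤-Reasoning )
open import Data.Product using (Σ; ∃-syntax; _×_; _,_; proj₁; proj₂)
open import Data.Sum using (_⊎_; inj₁; inj₂)
import Data.Sum as Sum
open import Data.Unit using (⊤; tt)
open import Data.Vec using (tabulate)
open import Data.Vec.Properties using (lookup∘tabulate; []=⇒lookup; lookup⇒[]=)
open import Function using (_∘_)
open import Function.Bundles using (Inverse; _⇔_; mk⇔; mk↔ₛ′; Equivalence)
open import Function.Definitions using (Injective)
open import Relation.Binary.Definitions using (tri<; tri≈; tri>)
open import Relation.Binary.PropositionalEquality
  using (_≡_; _≢_; refl; sym; trans; cong; subst; subst₂)
open import Relation.Nullary using (Dec; yes; no; contradiction)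
open import Relation.Nullary.Decidable using (_⊎-dec_)

private variable
  n : ℕ

∈-tabulate⁺ : ∀ {f : Fin n → Bool} {x} → f x ≡ true → x ∈ tabulate f
∈-tabulate⁺ {f = f} {x} fx = lookup⇒[]= x (tabulate f) (trans (lookup∘tabulate f x) fx)

∈-tabulate⁻ : ∀ {f : Fin n → Bool} {x} → x ∈ tabulate f → f x ≡ true
∈-tabulate⁻ {f = f} {x} x∈ = trans (sym (lookup∘tabulate f x)) ([]=⇒lookup x∈)

below : (Fin n → ℕ) → ℕ → Subset n
below f c = tabulate λ u → f u <ᵇ c

∈-below⁺ : ∀ (f : Fin n → ℕ) {c u} → f u < c → u ∈ below f c
∈-below⁺ f fu<c = ∈-tabulate⁺ (Equivalence.to T-≡ (<⇒<ᵇ fu<c))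

∈-below⁻ : ∀ (f : Fin n → ℕ) {c u} → u ∈ below f c → f u < c
∈-below⁻ f {c} {u} u∈ = <ᵇ⇒< (f u) c (Equivalence.from T-≡ (∈-tabulate⁻ u∈))

x∈p⇒1≤∣p∣ : ∀ {p : Subset n} {x} → x ∈ p → 1 ≤ ∣ p ∣
x∈p⇒1≤∣p∣ x∈p = ≤-trans (s≤s z≤n) (x∈p⇒∣p-x∣<∣p∣ x∈p)

x∉p⇒∣p∣<n : ∀ {p : Subset n} {x} → x ∉ p → ∣ p ∣ < n
x∉p⇒∣p∣<n {n} {p} {x} x∉p = subst (∣ p ∣ <_) (∣⊤∣≡n n) (p⊂q⇒∣p∣<∣q∣ (⊆⊤ , x , ∈⊤ , x∉p))

injective⇒surjective : (f : Fin n → Fin n) → Injective _≡_ _≡_ f → ∀ i → ∃[ v ] f v ≡ i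
injective⇒surjective {suc n} f f-injective i with any? (λ v → f v ≟ i)
... | yes hit = hit
... | no miss = contradiction (injective⇒≤ g-injective) (<-irrefl refl)
  where
  i≢f : ∀ v → i ≢ f v
  i≢f v i≡fv = miss (v , sym i≡fv)

  g : Fin (suc n) → Fin n
  g v = punchOut (i≢f v)

  g-injective : Injective _≡_ _≡_ g
  g-injective {u} {v} = f-injective ∘ punchOut-injective (i≢f u) (i≢f v)

lex-< : ∀ {x y a b N} → x < N → a < b → x + N * a < y + N * b
lex-< {x} {y} {a} {b} {N} x<N a<b = begin-strict
  x + N * a  <⟨ +-monoˡ-< (N * a) x<N ⟩
  N + N * a  ≡⟨ sym (*-suc N a) ⟩
  N * suc a  ≤⟨ *-monoʳ-≤ N a<b ⟩
  N * b      ≤⟨ m≤n+m (N * b) y ⟩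
  y + N * b  ∎
  where open ≤-Reasoning

Initial : (Fin n → ℕ) → Subset n → Set
Initial key A = ∀ {u v} → u ∈ A → v ∉ A → key u < key v

module SortOn (key : Fin n → ℕ) where

  tiebroken : Fin n → ℕ
  tiebroken v = toℕ v + n * key v

  tiebroken-< : ∀ {u v} → key u < key v → tiebroken u < tiebroken v
  tiebroken-< {u} = lex-< (toℕ<n u)

  tiebroken-injective : Injective _≡_ _≡_ tiebroken
  tiebroken-injective {u} {v} eq with <-cmp (key u) (key v)
  ... | tri< ku<kv _ _ = contradiction eq (<⇒≢ (tiebroken-< ku<kv))
  ... | tri> _ _ kv<ku = contradiction (sym eq) (<⇒≢ (tiebroken-< kv<ku))
  ... | tri≈ _ ku≡kv _ =
    toℕ-injective (+-cancelʳ-≡ (n * key v) _ _ (subst (λ k → toℕ u + n * k ≡ tiebroken v) ku≡kv eq))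

  rank : Fin n → ℕ
  rank v = ∣ below tiebroken (tiebroken v) ∣

  ∉below-self : ∀ v → v ∉ below tiebroken (tiebroken v)
  ∉below-self v v∈ = <-irrefl refl (∈-below⁻ tiebroken v∈)

  rank-< : ∀ {u v} → tiebroken u < tiebroken v → rank u < rank v
  rank-< {u} tu<tv = p⊂q⇒∣p∣<∣q∣
    ( (λ w∈ → ∈-below⁺ tiebroken (<-trans (∈-below⁻ tiebroken w∈) tu<tv))
    , u , ∈-below⁺ tiebroken tu<tv , ∉below-self u )

  rank-injective : Injective _≡_ _≡_ rank
  rank-injective {u} {v} eq with <-cmp (tiebroken u) (tiebroken v)
  ... | tri< tu<tv _ _ = contradiction eq (<⇒≢ (rank-< tu<tv))
  ... | tri≈ _ tu≡tv _ = tiebroken-injective tu≡tv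
  ... | tri> _ _ tv<tu = contradiction (sym eq) (<⇒≢ (rank-< tv<tu))

  position : Fin n → Fin n
  position v = fromℕ< (x∉p⇒∣p∣<n (∉below-self v))

  toℕ-position : ∀ v → toℕ (position v) ≡ rank v
  toℕ-position v = toℕ-fromℕ< _

  position-injective : Injective _≡_ _≡_ position
  position-injective {u} {v} eq =
    rank-injective (trans (sym (toℕ-position u)) (trans (cong toℕ eq) (toℕ-position v)))

  position-surjective : ∀ i → ∃[ v ] position v ≡ i
  position-surjective = injective⇒surjective position position-injective

  vertexAt : Fin n → Fin n
  vertexAt i = proj₁ (position-surjective i)

  sorted : Ordering n
  sorted = mk↔ₛ′ vertexAt position
    (λ v → position-injective (proj₂ (position-surjective (position v))))
    (λ i → proj₂ (position-surjective i))

  rank-vertexAt : ∀ i → rank (vertexAt i) ≡ toℕ i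
  rank-vertexAt i =
    trans (sym (toℕ-position (vertexAt i))) (cong toℕ (proj₂ (position-surjective i)))

  key-<⇒before : ∀ {u} i → key u < key (vertexAt i) → u ∈ before sorted i
  key-<⇒before {u} i ku<kv = ∈-below⁺ (toℕ ∘ position)
    (subst₂ _<_ (sym (toℕ-position u)) (rank-vertexAt i) (rank-< (tiebroken-< ku<kv)))

  rank<∣∣⇔∈ : ∀ {A} → Initial key A → ∀ v → rank v < ∣ A ∣ ⇔ v ∈ A
  rank<∣∣⇔∈ {A} A-initial v = mk⇔ in-A rank<∣A∣
    where
    in-A : rank v < ∣ A ∣ → v ∈ A
    in-A r<A with v ∈? A
    ... | yes v∈A = v∈A
    ... | no v∉A = contradiction
      (p⊆q⇒∣p∣≤∣q∣ λ u∈A → ∈-below⁺ tiebroken (tiebroken-< (A-initial u∈A v∉A))) (<⇒≱ r<A)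

    rank<∣A∣ : v ∈ A → rank v < ∣ A ∣
    rank<∣A∣ v∈A = p⊂q⇒∣p∣<∣q∣ (below⊆A , v , v∈A , ∉below-self v)
      where
      below⊆A : below tiebroken (tiebroken v) ⊆ A
      below⊆A {u} u∈ with u ∈? A
      ... | yes u∈A = u∈A
      ... | no u∉A = contradiction (∈-below⁻ tiebroken u∈) (<⇒≯ (tiebroken-< (A-initial v∈A u∉A)))

  position-initial : ∀ {A} → Initial key A → ∀ i → toℕ i < ∣ A ∣ ⇔ vertexAt i ∈ A
  position-initial {A} A-initial i =
    subst (λ r → r < ∣ A ∣ ⇔ vertexAt i ∈ A) (rank-vertexAt i) (rank<∣∣⇔∈ A-initial (vertexAt i))

  position-between : ∀ {A B} → Initial key A → Initial key B →
    ∀ i → (∣ A ∣ ≤ toℕ i × toℕ i < ∣ B ∣) ⇔ (vertexAt i ∈ B × vertexAt i ∉ A)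
  position-between A-initial B-initial i = mk⇔
    (λ (A≤i , i<B) → to B-pos i<B , λ w∈A → ≤⇒≯ A≤i (from A-pos w∈A))
    (λ (w∈B , w∉A) → ≮⇒≥ (w∉A ∘ to A-pos) , from B-pos w∈B)
    where
    open Equivalence
    A-pos = position-initial A-initial i
    B-pos = position-initial B-initial i

module _ (G : Graph n) where

  nbhd-sym : ∀ {u v} → u ∈ nbhd G v → v ∈ nbhd G u
  nbhd-sym {u} {v} u∈ = ∈-tabulate⁺ (trans (Graph.sym G u v) (∈-tabulate⁻ u∈))

  ∩-nbhd-mono : ∀ P Q {v} → (∀ {u} → u ∈ P → u ∈ nbhd G v → u ∈ Q) → P ∩ nbhd G v ⊆ Q ∩ nbhd G v
  ∩-nbhd-mono P Q P⊆Q u∈ = let (u∈P , u∈N) = x∈p∩q⁻ P _ u∈ in x∈p∩q⁺ (P⊆Q u∈P u∈N , u∈N)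

  degIn-mono : ∀ P Q {v} → (∀ {u} → u ∈ P → u ∈ nbhd G v → u ∈ Q) → degIn G P v ≤ degIn G Q v
  degIn-mono P Q P⊆Q = p⊆q⇒∣p∣≤∣q∣ (∩-nbhd-mono P Q P⊆Q)

  degIn-< : ∀ {P Q v y} → (∀ {u} → u ∈ P → u ∈ nbhd G v → u ∈ Q) →
    y ∈ Q → y ∈ nbhd G v → y ∉ P → degIn G P v < degIn G Q v
  degIn-< {P} {Q} {v} P⊆Q y∈Q y∈N y∉P = p⊂q⇒∣p∣<∣q∣
    (∩-nbhd-mono P Q P⊆Q , _ , x∈p∩q⁺ (y∈Q , y∈N) , y∉P ∘ proj₁ ∘ x∈p∩q⁻ P (nbhd G v))

  core-antitone : ∀ {j k K D} → j ≤ k → IsCore k G K → IsCore j G D → K ⊆ D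
  core-antitone j≤k (K-deg , _) (_ , D-max) = D-max _ λ v v∈K → ≤-trans j≤k (K-deg v v∈K)

indexOf : Fin n → List (Fin n) → ℕ
indexOf v [] = 0
indexOf v (m ∷ M) with v ≟ m
... | yes _ = 0
... | no _ = suc (indexOf v M)

indexOf-≤-length : ∀ v (M : List (Fin n)) → indexOf v M ≤ length M
indexOf-≤-length v [] = z≤n
indexOf-≤-length v (m ∷ M) with v ≟ m
... | yes _ = z≤n
... | no _ = s≤s (indexOf-≤-length v M)

indexOf-<-length⇒∈ : ∀ {v} (M : List (Fin n)) → indexOf v M < length M → v ∈ₗ M
indexOf-<-length⇒∈ {v = v} (m ∷ M) i<l with v ≟ m
... | yes v≡m = here v≡m
... | no _ = there (indexOf-<-length⇒∈ M (s≤s⁻¹ i<l))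

earlier : List (Fin n) → Fin n → Subset n
earlier M v = below (λ u → indexOf u M) (indexOf v M)

earlier⁺ : ∀ {u v} (M : List (Fin n)) → indexOf u M < indexOf v M → u ∈ earlier M v
earlier⁺ M = ∈-below⁺ (λ w → indexOf w M)

earlier⁻ : ∀ {u v} (M : List (Fin n)) → u ∈ earlier M v → indexOf u M < indexOf v M
earlier⁻ {v = v} M = ∈-below⁻ (λ w → indexOf w M) {indexOf v M}

earlier⇒∈ₗ : ∀ {u v} (M : List (Fin n)) → u ∈ earlier M v → u ∈ₗ M
earlier⇒∈ₗ {v = v} M u∈ = indexOf-<-length⇒∈ M (<-≤-trans (earlier⁻ M u∈) (indexOf-≤-length v M))

earlier-∷⁺ : ∀ {u v m} (M : List (Fin n)) → v ≢ m → u ≡ m ⊎ u ∈ earlier M v → u ∈ earlier (m ∷ M) v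
earlier-∷⁺ {u = u} {v} {m} M v≢m u-before = earlier⁺ (m ∷ M) index-<
  where
  index-< : indexOf u (m ∷ M) < indexOf v (m ∷ M)
  index-< with u ≟ m | v ≟ m
  ... | _ | yes v≡m = contradiction v≡m v≢m
  ... | yes _ | no _ = s≤s z≤n
  ... | no u≢m | no _ =
    s≤s (Sum.[ (λ u≡m → contradiction u≡m u≢m) , earlier⁻ M ] u-before)

earlier-∷⁻ : ∀ {u v m} (M : List (Fin n)) →
  u ∈ earlier (m ∷ M) v → v ≢ m × (u ≡ m ⊎ u ∈ earlier M v)
earlier-∷⁻ {u = u} {v} {m} M u∈ = split (earlier⁻ (m ∷ M) u∈)
  where
  split : indexOf u (m ∷ M) < indexOf v (m ∷ M) → v ≢ m × (u ≡ m ⊎ u ∈ earlier M v)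
  split i<j with u ≟ m | v ≟ m
  ... | _ | yes _ = contradiction i<j n≮0
  ... | yes u≡m | no v≢m = v≢m , inj₁ u≡m
  ... | no _ | no v≢m = v≢m , inj₂ (earlier⁺ M (s≤s⁻¹ i<j))

module Extensions (G : Graph n) (d : ℕ) where

  Extension : Subset n → List (Fin n) → Set
  Extension S [] = ⊤
  Extension S (m ∷ M) = m ∉ S × d ≤ degIn G S m × Extension (⁅ m ⁆ ∪ S) M

  Covers : Subset n → List (Fin n) → Set
  Covers S M = ∀ {v} → v ∉ S → v ∈ₗ M

  extension-disjoint : ∀ {S M v} → Extension S M → v ∈ₗ M → v ∉ S
  extension-disjoint (m∉S , _) (here refl) = m∉S
  extension-disjoint (_ , _ , ext) (there v∈M) v∈S = extension-disjoint ext v∈M (x∈p∪q⁺ (inj₂ v∈S))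

  extension-degree : ∀ {S M v} → Extension S M → v ∈ₗ M → d ≤ degIn G (S ∪ earlier M v) v
  extension-degree {S} {m ∷ M} (_ , m-deg , _) (here refl) =
    ≤-trans m-deg (degIn-mono G S (S ∪ earlier (m ∷ M) m) λ u∈S _ → p⊆p∪q _ u∈S)
  extension-degree {S} {m ∷ M} {v} (_ , _ , ext) (there v∈M) =
    ≤-trans (extension-degree ext v∈M) (degIn-mono G _ _ λ u∈ _ → shift u∈)
    where
    v≢m : v ≢ m
    v≢m refl = extension-disjoint ext v∈M (x∈p∪q⁺ (inj₁ (x∈⁅x⁆ m)))

    shift : ∀ {u} → u ∈ (⁅ m ⁆ ∪ S) ∪ earlier M v → u ∈ S ∪ earlier (m ∷ M) v
    shift u∈ with x∈p∪q⁻ (⁅ m ⁆ ∪ S) _ u∈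
    ... | inj₂ u∈earlier = x∈p∪q⁺ (inj₂ (earlier-∷⁺ M v≢m (inj₂ u∈earlier)))
    ... | inj₁ u∈m∪S with x∈p∪q⁻ ⁅ m ⁆ S u∈m∪S
    ...   | inj₁ u∈m = x∈p∪q⁺ (inj₂ (earlier-∷⁺ M v≢m (inj₁ (x∈⁅y⁆⇒x≡y m u∈m))))
    ...   | inj₂ u∈S = x∈p∪q⁺ (inj₁ u∈S)

  extension-∷ : ∀ {S w M} → w ∉ S → d ≤ degIn G S w →
    Extension (⁅ w ⁆ ∪ S) M × Covers (⁅ w ⁆ ∪ S) M → Extension S (w ∷ M) × Covers S (w ∷ M)
  extension-∷ {S} {w} w∉S w-deg (ext , covers) = (w∉S , w-deg , ext) , covers′
    where
    covers′ : Covers S (w ∷ _)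
    covers′ {v} v∉S with v ≟ w
    ... | yes v≡w = here v≡w
    ... | no v≢w = there (covers (Sum.[ v≢w ∘ x∈⁅y⁆⇒x≡y w , v∉S ] ∘ x∈p∪q⁻ ⁅ w ⁆ S))

  extend : Neighbourly d G → ∀ S → 2 * ∣ ∁ S ∣ ≤ n → ∃[ M ] Extension S M × Covers S M
  extend neighbourly S = go ∣ ∁ S ∣ S ≤-refl
    where
    go : ∀ fuel S → ∣ ∁ S ∣ ≤ fuel → 2 * ∣ ∁ S ∣ ≤ n → ∃[ M ] Extension S M × Covers S M
    go zero S ∣∁S∣≤0 _ =
      [] , tt , λ v∉S → contradiction (≤-trans (x∈p⇒1≤∣p∣ (x∉p⇒x∈∁p v∉S)) ∣∁S∣≤0) λ ()
    go (suc fuel) S ∣∁S∣≤ small with nonempty? (∁ S)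
    ... | no ∁S-empty = [] , tt , λ {v} v∉S → contradiction (v , x∉p⇒x∈∁p v∉S) ∁S-empty
    ... | yes (_ , v∈∁S) with neighbourly (∁ S) (x∈p⇒1≤∣p∣ v∈∁S) small
    ... | w , w∈∁S , w-deg =
      let M , rest = go fuel (⁅ w ⁆ ∪ S) shrinks
                       (≤-trans (*-monoʳ-≤ 2 (p⊆q⇒∣p∣≤∣q∣ ∁-shrinks)) small)
      in w ∷ M , extension-∷ (x∈∁p⇒x∉p w∈∁S) w-deg′ rest
      where
      ∁-shrinks : ∁ (⁅ w ⁆ ∪ S) ⊆ ∁ S
      ∁-shrinks = p⊆q⇒∁p⊇∁q (x∈p∪q⁺ ∘ inj₂)

      shrinks : ∣ ∁ (⁅ w ⁆ ∪ S) ∣ ≤ fuel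
      shrinks = s≤s⁻¹ (<-≤-trans (p⊂q⇒∣p∣<∣q∣
        (∁-shrinks , w , w∈∁S , x∈p⇒x∉∁p (x∈p∪q⁺ (inj₁ (x∈⁅x⁆ w))))) ∣∁S∣≤)

      w-deg′ : d ≤ degIn G S w
      w-deg′ = ≤-trans w-deg (degIn-mono G (∁ (∁ S)) S λ u∈∁∁S _ → x∉∁p⇒x∈p (x∈∁p⇒x∉p u∈∁∁S))

  module Reach (D : Subset n) where

    Enters : Fin n → Subset n → Set
    Enters m R = m ∈ D ⊎ Nonempty (nbhd G m ∩ R)

    enters? : ∀ m R → Dec (Enters m R)
    enters? m R = m ∈? D ⊎-dec nonempty? (nbhd G m ∩ R)

    -- The vertices of M from which D is reached along a path moving forward in M.
    reach : List (Fin n) → Subset n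
    reach [] = ⊥
    reach (m ∷ M) with enters? m (reach M)
    ... | yes _ = ⁅ m ⁆ ∪ reach M
    ... | no _ = reach M

    reach-∷⁺ : ∀ m M → Enters m (reach M) → m ∈ reach (m ∷ M)
    reach-∷⁺ m M enters with enters? m (reach M)
    ... | yes _ = x∈p∪q⁺ (inj₁ (x∈⁅x⁆ m))
    ... | no ¬enters = contradiction enters ¬enters

    reach-⊆-∷ : ∀ m M → reach M ⊆ reach (m ∷ M)
    reach-⊆-∷ m M v∈ with enters? m (reach M)
    ... | yes _ = x∈p∪q⁺ (inj₂ v∈)
    ... | no _ = v∈

    reach-∷⁻ : ∀ m M {v} → v ∈ reach (m ∷ M) → (v ≡ m × Enters m (reach M)) ⊎ v ∈ reach M
    reach-∷⁻ m M v∈ with enters? m (reach M)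
    ... | yes enters = Sum.map₁ (λ v∈m → x∈⁅y⁆⇒x≡y m v∈m , enters) (x∈p∪q⁻ ⁅ m ⁆ (reach M) v∈)
    ... | no _ = inj₂ v∈

    reach⇒∈ₗ : ∀ M {v} → v ∈ reach M → v ∈ₗ M
    reach⇒∈ₗ [] v∈ = ⊥-elim (∉⊥ v∈)
    reach⇒∈ₗ (m ∷ M) v∈ = Sum.[ here ∘ proj₁ , there ∘ reach⇒∈ₗ M ] (reach-∷⁻ m M v∈)

    ∈D⇒reach : ∀ {M v} → v ∈ D → v ∈ₗ M → v ∈ reach M
    ∈D⇒reach {m ∷ M} v∈D (here refl) = reach-∷⁺ m M (inj₁ v∈D)
    ∈D⇒reach {m ∷ M} v∈D (there v∈M) = reach-⊆-∷ m M (∈D⇒reach v∈D v∈M)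

    reach-earlier-closed : ∀ M {u v} → v ∈ reach M → u ∈ earlier M v → u ∈ nbhd G v → u ∈ reach M
    reach-earlier-closed [] v∈ = ⊥-elim (∉⊥ v∈)
    reach-earlier-closed (m ∷ M) {v = v} v∈ u∈earlier u~v
      with earlier-∷⁻ M u∈earlier | reach-∷⁻ m M v∈
    ... | v≢m , _ | inj₁ (v≡m , _) = contradiction v≡m v≢m
    ... | _ , inj₁ refl | inj₂ v∈R = reach-∷⁺ m M (inj₂ (v , x∈p∩q⁺ (nbhd-sym G u~v , v∈R)))
    ... | _ , inj₂ u∈earlier′ | inj₂ v∈R = reach-⊆-∷ m M (reach-earlier-closed M v∈R u∈earlier′ u~v)

    -- T stands for the final reach set; the last hypothesis is the invariant that lets the
    -- induction run along M while S absorbs its head.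
    reach-degree : ∀ {S} M → Extension S M → ∀ T → reach M ⊆ T →
      (∀ {u y} → u ∈ S → y ∈ reach M → y ∈ nbhd G u → u ∈ D ∪ T) →
      ∀ {v} → v ∈ reach M → v ∉ D → suc d ≤ degIn G (D ∪ T) v
    reach-degree [] _ _ _ _ v∈ _ = ⊥-elim (∉⊥ v∈)
    reach-degree {S} (m ∷ M) (_ , m-deg , ext) T reach⊆T S-attached v∈ v∉D with reach-∷⁻ m M v∈
    ... | inj₂ v∈R = reach-degree M ext T (reach⊆T ∘ reach-⊆-∷ m M) attached v∈R v∉D
      where
      m∈T : ∀ {y} → y ∈ reach M → y ∈ nbhd G m → m ∈ D ∪ T
      m∈T {y} y∈R y~m = q⊆p∪q D T (reach⊆T (reach-∷⁺ m M (inj₂ (y , x∈p∩q⁺ (y~m , y∈R)))))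

      attached : ∀ {u y} → u ∈ ⁅ m ⁆ ∪ S → y ∈ reach M → y ∈ nbhd G u → u ∈ D ∪ T
      attached u∈ y∈R y~u with x∈p∪q⁻ ⁅ m ⁆ S u∈
      ... | inj₁ u∈m with refl ← x∈⁅y⁆⇒x≡y m u∈m = m∈T y∈R y~u
      ... | inj₂ u∈S = S-attached u∈S (reach-⊆-∷ m M y∈R) y~u
    ... | inj₁ (refl , inj₁ m∈D) = contradiction m∈D v∉D
    ... | inj₁ (refl , inj₂ (y , y∈)) = ≤-trans (s≤s m-deg) (degIn-< G
      (λ u∈S u~m → S-attached u∈S v∈ (nbhd-sym G u~m))
      (q⊆p∪q D T (reach⊆T (reach-⊆-∷ m M y∈R))) y~m
      (λ y∈S → extension-disjoint ext (reach⇒∈ₗ M y∈R) (q⊆p∪q ⁅ m ⁆ S y∈S)))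
      where
      y~m = proj₁ (x∈p∩q⁻ (nbhd G m) _ y∈)
      y∈R = proj₂ (x∈p∩q⁻ (nbhd G m) _ y∈)

    reach⊆core : ∀ {K M} → IsCore (suc d) G D → K ⊆ D → Extension K M → reach M ⊆ D
    reach⊆core {M = M} (D-deg , D-max) K⊆D ext = D-max (D ∪ reach M) D∪R-deg ∘ x∈p∪q⁺ ∘ inj₂
      where
      D∪R-deg : MinDegAtLeast (suc d) G (D ∪ reach M)
      D∪R-deg v v∈ with v ∈? D | x∈p∪q⁻ D (reach M) v∈
      ... | yes v∈D | _ = ≤-trans (D-deg v v∈D) (degIn-mono G D (D ∪ reach M) λ u∈D _ → p⊆p∪q _ u∈D)
      ... | no v∉D | inj₁ v∈D = contradiction v∈D v∉D
      ... | no v∉D | inj₂ v∈R =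
        reach-degree M ext (reach M) (λ r → r) (λ u∈K _ _ → p⊆p∪q _ (K⊆D u∈K)) v∈R v∉D

    earlier-neighbour-∈core : ∀ {K M u v} → IsCore (suc d) G D → K ⊆ D → Extension K M →
      v ∈ D → v ∈ₗ M → u ∈ earlier M v → u ∈ nbhd G v → u ∈ D
    earlier-neighbour-∈core {M = M} core K⊆D ext v∈D v∈M u∈earlier u~v =
      reach⊆core core K⊆D ext (reach-earlier-closed M (∈D⇒reach v∈D v∈M) u∈earlier u~v)

excluded : Subset n → Fin n → ℕ
excluded S v with v ∈? S
... | yes _ = 0
... | no _ = 1

excluded-< : ∀ {S : Subset n} {u v} → u ∈ S → v ∉ S → excluded S u < excluded S v
excluded-< {S = S} {u} {v} u∈S v∉S with u ∈? S | v ∈? S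
... | yes _ | no _ = s≤s z≤n
... | no u∉S | _ = contradiction u∈S u∉S
... | _ | yes v∈S = contradiction v∈S v∉S

excluded-mono : ∀ {S : Subset n} {u v} → (v ∈ S → u ∈ S) → excluded S u ≤ excluded S v
excluded-mono {S = S} {u} {v} v∈S⇒u∈S with u ∈? S | v ∈? S
... | yes _ | _ = z≤n
... | no _ | no _ = ≤-refl
... | no u∉S | yes v∈S = contradiction (v∈S⇒u∈S v∈S) u∉S

-- Vertices of K come first, then those of D ∖ K, then the rest; within each layer they
-- keep their order in M.
module Layered (K D : Subset n) (K⊆D : K ⊆ D) (M : List (Fin n)) where

  layer : Fin n → ℕ
  layer v = excluded K v + excluded D v

  key : Fin n → ℕ
  key v = indexOf v M + suc (length M) * layer v

  key-<-layer : ∀ {u v} → layer u < layer v → key u < key v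
  key-<-layer {u} {v} = lex-< {y = indexOf v M} (s≤s (indexOf-≤-length u M))

  K-initial : Initial key K
  K-initial u∈K v∉K = key-<-layer (+-mono-<-≤ (excluded-< u∈K v∉K) (excluded-mono λ _ → K⊆D u∈K))

  D-initial : Initial key D
  D-initial u∈D v∉D = key-<-layer
    (+-mono-≤-< (excluded-mono λ v∈K → contradiction (K⊆D v∈K) v∉D) (excluded-< u∈D v∉D))

  earlier-key-< : ∀ {u v} → u ∉ K → v ∉ K → (v ∈ D → u ∈ D) → u ∈ earlier M v → key u < key v
  earlier-key-< u∉K v∉K v∈D⇒u∈D u∈earlier = +-mono-<-≤ (earlier⁻ M u∈earlier)
    (*-monoʳ-≤ (suc (length M)) (+-mono-≤ (excluded-mono λ v∈K → contradiction v∈K v∉K)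
                                          (excluded-mono v∈D⇒u∈D)))

1+d≤d*[d+1] : ∀ {d} → 1 ≤ d → suc d ≤ d * (d + 1)
1+d≤d*[d+1] {d} 1≤d = subst (_≤ d * (d + 1)) (+-comm d 1) (m≤n*m (d + 1) d {{>-nonZero 1≤d}})

5n≤9k⇒2[n∸k]≤n : ∀ {n k} → k ≤ n → 5 * n ≤ 9 * k → 2 * (n ∸ k) ≤ n
5n≤9k⇒2[n∸k]≤n {n} {k} k≤n 5n≤9k = begin
  2 * x  ≡⟨ cong (x +_) (+-identityʳ x) ⟩
  x + x  ≤⟨ +-monoʳ-≤ x x≤k ⟩
  x + k  ≡⟨ m∸n+n≡m k≤n ⟩
  n      ∎
  where
  open ≤-Reasoning
  x = n ∸ k
  x≤k : x ≤ k
  x≤k = *-cancelˡ-≤ 4 (+-cancelʳ-≤ (5 * k) (4 * x) (4 * k) (begin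
    4 * x + 5 * k  ≤⟨ +-monoˡ-≤ (5 * k) (*-monoˡ-≤ x (n≤1+n 4)) ⟩
    5 * x + 5 * k  ≡⟨ sym (*-distribˡ-+ 5 x k) ⟩
    5 * (x + k)    ≡⟨ cong (5 *_) (m∸n+n≡m k≤n) ⟩
    5 * n          ≤⟨ 5n≤9k ⟩
    9 * k          ≡⟨ *-distribʳ-+ k 4 5 ⟩
    4 * k + 5 * k  ∎))

5n≤9∣p∣⇒2∣∁p∣≤n : ∀ (K : Subset n) → 5 * n ≤ 9 * ∣ K ∣ → 2 * ∣ ∁ K ∣ ≤ n
5n≤9∣p∣⇒2∣∁p∣≤n {n} K 5n≤9∣K∣ =
  subst (λ c → 2 * c ≤ n) (sym (∣∁p∣≡n∸∣p∣ K)) (5n≤9k⇒2[n∸k]≤n (∣p∣≤n K) 5n≤9∣K∣)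

lemma3p1 : (d k : ℕ) → 1 ≤ d → k ≡ d * (d + 1) →
    (n : ℕ) (G : Graph n) → Neighbourly d G →
    (K D : Subset n) → IsCore k G K → IsCore (suc d) G D →
    5 * n ≤ 9 * ∣ K ∣ →
    Σ (Ordering n) λ σ → Σ ℕ λ s → Σ ℕ λ t →
      s ≤ t × t ≤ n
      × (∀ (i : Fin n) → (toℕ i < s) ⇔ (Inverse.to σ i ∈ K))
      × (∀ (i : Fin n) →
           (s ≤ toℕ i × toℕ i < t) ⇔ (Inverse.to σ i ∈ D × Inverse.to σ i ∉ K))
      × (∀ (i : Fin n) → s ≤ toℕ i → d ≤ degIn G (before σ i) (Inverse.to σ i))
lemma3p1 d k 1≤d refl n G neighbourly K D K-core D-core 5n≤9∣K∣
  with Extensions.extend G d neighbourly K (5n≤9∣p∣⇒2∣∁p∣≤n K 5n≤9∣K∣)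
... | M , ext , covers =
  sorted , ∣ K ∣ , ∣ D ∣ , p⊆q⇒∣p∣≤∣q∣ K⊆D , ∣p∣≤n D ,
  position-initial K-initial , position-between K-initial D-initial , attached
  where
  open Extensions G d
  open Reach D

  K⊆D : K ⊆ D
  K⊆D = core-antitone G (1+d≤d*[d+1] 1≤d) K-core D-core

  open Layered K D K⊆D M
  open SortOn key

  attached : ∀ i → ∣ K ∣ ≤ toℕ i → d ≤ degIn G (before sorted i) (vertexAt i)
  attached i K≤i = ≤-trans (extension-degree ext (covers v∉K))
    (degIn-mono G _ _ λ u∈ u~v → key-<⇒before i (attached-key-< u∈ u~v))
    where
    v = vertexAt i

    v∉K : v ∉ K
    v∉K v∈K = ≤⇒≯ K≤i (Equivalence.from (position-initial K-initial i) v∈K)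

    attached-key-< : ∀ {u} → u ∈ K ∪ earlier M v → u ∈ nbhd G v → key u < key v
    attached-key-< u∈ u~v with x∈p∪q⁻ K _ u∈
    ... | inj₁ u∈K = K-initial u∈K v∉K
    ... | inj₂ u∈earlier = earlier-key-< (extension-disjoint ext (earlier⇒∈ₗ M u∈earlier)) v∉K
      (λ v∈D → earlier-neighbour-∈core D-core K⊆D ext v∈D (covers v∉K) u∈earlier u~v) u∈earlier
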